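{- Let $G$ be a triangle-free $4$-sunspot-free graph that is both liberal and flapless. Let $H$ be a hole of length at least $6$ in $G$, let $\Phi$ be an $H$-flare in $G$, let $h,h'\in V(H)$ be distinct, and let $x\in \Phi[h]$. Then: if $h,h'$ are adjacent, $x$ and $h'$ have no common neighbor in $V(G)\setminus V(H)$; and if $h,h'$ are non-adjacent, $x$ and $h'$ have at most one common neighbor in $V(G)\setminus V(H)$.
   Context: Graphs are finite and simple. A $4$-sunspot in $G$ is a $7$-tuple $(x_1,x_2,x_3,x_4;y_1,y_2,y_3)$ of pairwise distinct vertices such that the edges of $G$ among them are exactly $x_1x_2,x_2x_3,x_3x_4,x_4x_1,x_1y_1,x_2y_2,x_3y_3$; $G$ is $4$-sunspot-free if none exists. A hole is an induced cycle on at least four vertices, its length being its number of edges. For a hole $H$, an $H$-flap is a hole of length $4$ sharing at least one edge with $H$. $G$ is liberal if for all distinct non-adjacent vertices $x,y$, both $N(x)\setminus N(y)$ and $N(y)\setminus N(x)$ are nonempty; $G$ is flapless if for every hole $H$ of length at least $6$ there is no $H$-flap. For a hole $H$, an $H$-flare is a map $\Phi$ from $V(H)$ to subsets of $V(G)\setminus V(H)$ with $\Phi(h)\subseteq N_G(h)\setminus V(H)$ and $|\Phi(h)|\leq 1$ for all $h$; write $\Phi[h]=\Phi(h)\cup\{h\}$. -}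

module Defs where

open import Data.Nat using (ℕ; zero; suc; _≤_)
open import Data.Fin using (Fin; toℕ)
open import Data.Bool using (Bool; true; false)
open import Data.Product using (Σ; ∃; ∃-syntax; _×_; _,_)
open import Data.Sum using (_⊎_)
open import Data.Empty using (⊥)
open import Data.Unit using (⊤)
open import Relation.Nullary using (¬_)
open import Relation.Binary.PropositionalEquality using (_≡_; _≢_)
open import Function.Bundles using (_⇔_)

record Graph : Set where
  field
    n      : ℕ
    adj    : Fin n → Fin n → Bool
    sym    : ∀ u v → adj u v ≡ adj v u
    irrefl : ∀ u → adj u u ≡ false

module _ (G : Graph) where
  open Graph G

  V : Set
  V = Fin n

  Edge : V → V → Set
  Edge u v = adj u v ≡ true

  TriangleFree : Set
  TriangleFree = ∀ a b c → Edge a b → Edge b c → Edge a c → ⊥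

  -- 4-sunspot (x1,x2,x3,x4;y1,y2,y3) as a tuple indexed by Fin 7:
  -- indices 0..3 are x1..x4, indices 4..6 are y1..y3.
  sunspotPattern : Fin 7 → Fin 7 → Set
  sunspotPattern i j = SP (toℕ i) (toℕ j) ⊎ SP (toℕ j) (toℕ i)
    where
      SP : ℕ → ℕ → Set
      SP 0 1 = ⊤
      SP 1 2 = ⊤
      SP 2 3 = ⊤
      SP 3 0 = ⊤
      SP 0 4 = ⊤
      SP 1 5 = ⊤
      SP 2 6 = ⊤
      SP _ _ = ⊥

  Is4Sunspot : (Fin 7 → V) → Set
  Is4Sunspot s = (∀ i j → s i ≡ s j → i ≡ j)
               × (∀ i j → Edge (s i) (s j) ⇔ sunspotPattern i j)

  SunspotFree4 : Set
  SunspotFree4 = ∀ (s : Fin 7 → V) → ¬ Is4Sunspot s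

  Liberal : Set
  Liberal = ∀ x y → x ≢ y → ¬ Edge x y →
              (∃[ z ] (Edge x z × ¬ Edge y z)) × (∃[ z ] (Edge y z × ¬ Edge x z))

data CycAdj {len : ℕ} (i j : Fin len) : Set where
  fwd   : suc (toℕ i) ≡ toℕ j → CycAdj i j
  bwd   : suc (toℕ j) ≡ toℕ i → CycAdj i j
  wrapF : toℕ j ≡ 0 → suc (toℕ i) ≡ len → CycAdj i j
  wrapB : toℕ i ≡ 0 → suc (toℕ j) ≡ len → CycAdj i j

module _ (G : Graph) where
  open Graph G

  record Hole : Set where
    field
      len    : ℕ
      len≥4  : 4 ≤ len
      vtx    : Fin len → V G
      inj    : ∀ i j → vtx i ≡ vtx j → i ≡ j
      induced : ∀ i j → Edge G (vtx i) (vtx j) ⇔ CycAdj i j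

  open Hole public

  InHole : Hole → V G → Set
  InHole H u = ∃[ i ] (vtx H i ≡ u)

  HoleEdge : Hole → V G → V G → Set
  HoleEdge H u v = ∃[ i ] ∃[ j ] (CycAdj i j × vtx H i ≡ u × vtx H j ≡ v)

  IsFlap : Hole → Hole → Set
  IsFlap H F = len F ≡ 4 × ∃[ u ] ∃[ v ] (HoleEdge H u v × HoleEdge F u v)

  Flapless : Set
  Flapless = ∀ (H : Hole) → 6 ≤ len H → ∀ (F : Hole) → ¬ IsFlap H F

  record Flare (H : Hole) : Set₁ where
    field
      Φ      : Fin (len H) → V G → Set
      nbr    : ∀ i x → Φ i x → Edge G (vtx H i) x
      outH   : ∀ i x → Φ i x → ¬ InHole H x
      atMost1 : ∀ i x y → Φ i x → Φ i y → x ≡ y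

  -- Φ[h] = Φ(h) ∪ {h}
  FlareClosed : {H : Hole} → Flare H → Fin (len H) → V G → Set
  FlareClosed {H} F i x = Flare.Φ F i x ⊎ x ≡ vtx H i

-- Part 1 is a triangle or an H-flap: a common neighbour z ∉ H of x ∈ Φ(h) and of h' ~ h closes the
-- square h h' z x on the hole edge hh'.
-- Part 2: let z ≠ z' be two common neighbours of x and h' outside H, so x z h' z' is a square
-- (triangle-freeness makes every 4-cycle induced). Pick a hole vertex p ~ x with p ≁ h' (p = h, or
-- a hole neighbour of h when x = h) and a hole neighbour y of h' with p ≁ y. Flaplessness makes h'
-- the only common neighbour of y and z (and of y and z'). Liberality on z, z' gives b ~ z, b ≁ z' and
-- b' ~ z', b' ≁ z. Each of the non-edges bp, b'p, bb' would yield a 4-sunspot, so b b' p is a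
-- triangle.
module Submission where

open import Defs
open import Data.Nat using (ℕ; zero; suc; _≤_; _<_)
import Data.Nat as ℕ
open import Data.Nat.Properties using (≤-refl; <⇒≤; <⇒≱)
open import Data.Fin using (Fin; zero; suc; toℕ; fromℕ; inject₁; lower₁; _≟_)
open import Data.Fin.Patterns using (0F; 1F; 2F; 3F; 4F; 5F; 6F)
open import Data.Fin.Properties using (toℕ-fromℕ; toℕ-inject₁; toℕ-lower₁)
open import Data.Vec.Functional using (_∷_; [])
import Data.Bool as Bool
open import Data.Product using (Σ-syntax; ∃-syntax; _×_; _,_)
open import Data.Sum using (_⊎_; inj₁; inj₂; swap; reduce)
open import Data.Empty using (⊥; ⊥-elim)
open import Data.Unit using (tt)
open import Function using (_∘_; case_of_)
open import Function.Bundles using (_⇔_; mk⇔; Equivalence)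
open import Relation.Nullary using (¬_; Dec; yes; no)
open import Relation.Nullary.Decidable using (decidable-stable; map′; _⊎-dec_; _×-dec_; from-no)
open import Relation.Binary.PropositionalEquality using (_≡_; _≢_; refl; sym; trans; cong; ≢-sym)

open Equivalence using (to; from)

Next : ℕ → ℕ → ℕ → Set
Next L a b = suc a ≡ b ⊎ (b ≡ 0 × suc a ≡ L)

successor : ∀ {m} (i : Fin (suc m)) → Σ[ j ∈ Fin (suc m) ] Next (suc m) (toℕ i) (toℕ j)
successor {m} i with toℕ i ℕ.≟ m
... | yes i≡m = zero , inj₂ (refl , cong suc i≡m)
... | no i≢m = suc (lower₁ i (i≢m ∘ sym)) , inj₁ (cong suc (sym (toℕ-lower₁ i _)))

predecessor : ∀ {m} (i : Fin (suc m)) → Σ[ k ∈ Fin (suc m) ] Next (suc m) (toℕ k) (toℕ i)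
predecessor {m} zero = fromℕ m , inj₂ (refl , cong suc (toℕ-fromℕ m))
predecessor (suc i) = inject₁ i , inj₁ (cong suc (toℕ-inject₁ i))

Next-2-cycle : ∀ {L a b} → Next L a b → Next L b a → L ≤ 2
Next-2-cycle (inj₁ refl) (inj₁ ())
Next-2-cycle (inj₁ refl) (inj₂ (refl , refl)) = ≤-refl
Next-2-cycle (inj₂ (refl , refl)) (inj₁ refl) = ≤-refl
Next-2-cycle (inj₂ (refl , refl)) (inj₂ (refl , _)) = ℕ.s≤s ℕ.z≤n

Next⇒CycAdj : ∀ {L} {i j : Fin L} → Next L (toℕ i) (toℕ j) → CycAdj i j
Next⇒CycAdj (inj₁ e) = fwd e
Next⇒CycAdj (inj₂ (j≡0 , e)) = wrapF j≡0 e

Next⇒CycAdj⁻ : ∀ {L} {i j : Fin L} → Next L (toℕ j) (toℕ i) → CycAdj i j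
Next⇒CycAdj⁻ (inj₁ e) = bwd e
Next⇒CycAdj⁻ (inj₂ (i≡0 , e)) = wrapB i≡0 e

cycle-neighbours : ∀ {L} → 2 < L → (i : Fin L) →
                   Σ[ j ∈ Fin L ] Σ[ k ∈ Fin L ] j ≢ k × CycAdj i j × CycAdj i k
cycle-neighbours {suc m} 2<L i with successor i | predecessor i
... | j , i↦j | k , k↦i = j , k , j≢k , Next⇒CycAdj i↦j , Next⇒CycAdj⁻ k↦i
  where
  j≢k : j ≢ k
  j≢k refl = <⇒≱ 2<L (Next-2-cycle i↦j k↦i)

CycAdj-sym : ∀ {L} {i j : Fin L} → CycAdj i j → CycAdj j i
CycAdj-sym (fwd e) = bwd e
CycAdj-sym (bwd e) = fwd e
CycAdj-sym (wrapF j≡0 e) = wrapB j≡0 e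
CycAdj-sym (wrapB i≡0 e) = wrapF i≡0 e

cycAdj? : ∀ {L} (i j : Fin L) → Dec (CycAdj i j)
cycAdj? {L} i j =
  map′ fromSum toSum
    ((suc (toℕ i) ℕ.≟ toℕ j ⊎-dec suc (toℕ j) ℕ.≟ toℕ i)
      ⊎-dec ((toℕ j ℕ.≟ 0 ×-dec suc (toℕ i) ℕ.≟ L)
               ⊎-dec (toℕ i ℕ.≟ 0 ×-dec suc (toℕ j) ℕ.≟ L)))
  where
  Unfolded : Set
  Unfolded = (suc (toℕ i) ≡ toℕ j ⊎ suc (toℕ j) ≡ toℕ i)
           ⊎ ((toℕ j ≡ 0 × suc (toℕ i) ≡ L) ⊎ (toℕ i ≡ 0 × suc (toℕ j) ≡ L))
  fromSum : Unfolded → CycAdj i j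
  fromSum (inj₁ (inj₁ e)) = fwd e
  fromSum (inj₁ (inj₂ e)) = bwd e
  fromSum (inj₂ (inj₁ (j≡0 , e))) = wrapF j≡0 e
  fromSum (inj₂ (inj₂ (i≡0 , e))) = wrapB i≡0 e
  toSum : CycAdj i j → Unfolded
  toSum (fwd e) = inj₁ (inj₁ e)
  toSum (bwd e) = inj₁ (inj₂ e)
  toSum (wrapF j≡0 e) = inj₂ (inj₁ (j≡0 , e))
  toSum (wrapB i≡0 e) = inj₂ (inj₂ (i≡0 , e))

module Basics (G : Graph) where

  private variable
    t u v w : V G
    A B : Set

  Edge-sym : Edge G u v → Edge G v u
  Edge-sym {u} {v} e = trans (Graph.sym G v u) e

  ≁-sym : ¬ Edge G u v → ¬ Edge G v u
  ≁-sym u≁v = u≁v ∘ Edge-sym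

  Edge-irrefl : ¬ Edge G u u
  Edge-irrefl {u} e = case trans (sym e) (Graph.irrefl G u) of λ ()

  Edge⇒≢ : Edge G u v → u ≢ v
  Edge⇒≢ e refl = Edge-irrefl e

  ≢-by : Edge G u w → ¬ Edge G v w → u ≢ v
  ≢-by u~w v≁w refl = v≁w u~w

  edge? : ∀ u v → Dec (Edge G u v)
  edge? u v = Graph.adj G u v Bool.≟ Bool.true

  Edge-stable : ¬ ¬ Edge G u v → Edge G u v
  Edge-stable = decidable-stable (edge? _ _)

  OnlyCommonNeighbour : V G → V G → V G → Set
  OnlyCommonNeighbour u v w = ∀ {t} → Edge G u t → Edge G v t → t ≡ w

  OnlyCommonNeighbour⇒≁ : OnlyCommonNeighbour u v w → Edge G v t → t ≢ w → ¬ Edge G u t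
  OnlyCommonNeighbour⇒≁ only v~t t≢w u~t = t≢w (only u~t v~t)

  present : Edge G u v → A → (Edge G u v ⇔ A)
  present e a = mk⇔ (λ _ → a) (λ _ → e)

  absent : ¬ Edge G u v → ¬ A → (Edge G u v ⇔ A)
  absent u≁v ¬a = mk⇔ (⊥-elim ∘ u≁v) (⊥-elim ∘ ¬a)

  ⇔-flip : (A → B) → (B → A) → (Edge G u v ⇔ A) → (Edge G v u ⇔ B)
  ⇔-flip f g uv⇔A = mk⇔ (f ∘ to uv⇔A ∘ Edge-sym) (Edge-sym ∘ from uv⇔A ∘ g)

module Configurations (G : Graph) (tf : TriangleFree G) where
  open Basics G

  square-hole : ∀ {a b c d} → Edge G a b → Edge G b c → Edge G c d → Edge G d a →
                a ≢ c → b ≢ d → Hole G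
  square-hole {a} {b} {c} {d} a~b b~c c~d d~a a≢c b≢d =
    record { len = 4 ; len≥4 = ≤-refl ; vtx = corners ; inj = injective ; induced = faithful }
    where
    corners : Fin 4 → V G
    corners = a ∷ b ∷ c ∷ d ∷ []

    faithful : ∀ i j → Edge G (corners i) (corners j) ⇔ CycAdj i j
    faithful 0F 0F = absent Edge-irrefl (from-no (cycAdj? {4} 0F 0F))
    faithful 0F 1F = present a~b (fwd refl)
    faithful 0F 2F = absent (tf a b c a~b b~c) (from-no (cycAdj? {4} 0F 2F))
    faithful 0F 3F = present (Edge-sym d~a) (wrapB refl refl)
    faithful 1F 1F = absent Edge-irrefl (from-no (cycAdj? {4} 1F 1F))
    faithful 1F 2F = present b~c (fwd refl)
    faithful 1F 3F = absent (tf b c d b~c c~d) (from-no (cycAdj? {4} 1F 3F))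
    faithful 2F 2F = absent Edge-irrefl (from-no (cycAdj? {4} 2F 2F))
    faithful 2F 3F = present c~d (fwd refl)
    faithful 3F 3F = absent Edge-irrefl (from-no (cycAdj? {4} 3F 3F))
    faithful 1F 0F = ⇔-flip CycAdj-sym CycAdj-sym (faithful 0F 1F)
    faithful 2F 0F = ⇔-flip CycAdj-sym CycAdj-sym (faithful 0F 2F)
    faithful 3F 0F = ⇔-flip CycAdj-sym CycAdj-sym (faithful 0F 3F)
    faithful 2F 1F = ⇔-flip CycAdj-sym CycAdj-sym (faithful 1F 2F)
    faithful 3F 1F = ⇔-flip CycAdj-sym CycAdj-sym (faithful 1F 3F)
    faithful 3F 2F = ⇔-flip CycAdj-sym CycAdj-sym (faithful 2F 3F)

    injective : ∀ i j → corners i ≡ corners j → i ≡ j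
    injective 0F 0F _ = refl
    injective 0F 1F = ⊥-elim ∘ Edge⇒≢ a~b
    injective 0F 2F = ⊥-elim ∘ a≢c
    injective 0F 3F = ⊥-elim ∘ Edge⇒≢ (Edge-sym d~a)
    injective 1F 1F _ = refl
    injective 1F 2F = ⊥-elim ∘ Edge⇒≢ b~c
    injective 1F 3F = ⊥-elim ∘ b≢d
    injective 2F 2F _ = refl
    injective 2F 3F = ⊥-elim ∘ Edge⇒≢ c~d
    injective 3F 3F _ = refl
    injective 1F 0F e = sym (injective 0F 1F (sym e))
    injective 2F 0F e = sym (injective 0F 2F (sym e))
    injective 3F 0F e = sym (injective 0F 3F (sym e))
    injective 2F 1F e = sym (injective 1F 2F (sym e))
    injective 3F 1F e = sym (injective 1F 3F (sym e))
    injective 3F 2F e = sym (injective 2F 3F (sym e))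

  -- The eight non-edges of a 4-sunspot not listed here are forced by triangle-freeness.
  sunspot : ∀ {x₁ x₂ x₃ x₄ y₁ y₂ y₃} →
            Edge G x₁ x₂ → Edge G x₂ x₃ → Edge G x₃ x₄ → Edge G x₄ x₁ →
            Edge G x₁ y₁ → Edge G x₂ y₂ → Edge G x₃ y₃ →
            ¬ Edge G x₃ y₁ → ¬ Edge G x₄ y₂ → ¬ Edge G x₁ y₃ →
            ¬ Edge G y₁ y₂ → ¬ Edge G y₁ y₃ → ¬ Edge G y₂ y₃ →
            Is4Sunspot G (x₁ ∷ x₂ ∷ x₃ ∷ x₄ ∷ y₁ ∷ y₂ ∷ y₃ ∷ [])
  sunspot {x₁} {x₂} {x₃} {x₄} {y₁} {y₂} {y₃} x₁~x₂ x₂~x₃ x₃~x₄ x₄~x₁ x₁~y₁ x₂~y₂ x₃~y₃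
          x₃≁y₁ x₄≁y₂ x₁≁y₃ y₁≁y₂ y₁≁y₃ y₂≁y₃ = injective , faithful
    where
    s : Fin 7 → V G
    s = x₁ ∷ x₂ ∷ x₃ ∷ x₄ ∷ y₁ ∷ y₂ ∷ y₃ ∷ []

    x₁≁x₃ : ¬ Edge G x₁ x₃
    x₁≁x₃ = tf x₁ x₂ x₃ x₁~x₂ x₂~x₃
    x₂≁x₄ : ¬ Edge G x₂ x₄
    x₂≁x₄ = tf x₂ x₁ x₄ (Edge-sym x₁~x₂) (Edge-sym x₄~x₁)
    x₂≁y₁ : ¬ Edge G x₂ y₁
    x₂≁y₁ = tf x₂ x₁ y₁ (Edge-sym x₁~x₂) x₁~y₁
    x₄≁y₁ : ¬ Edge G x₄ y₁
    x₄≁y₁ = tf x₄ x₁ y₁ x₄~x₁ x₁~y₁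
    x₁≁y₂ : ¬ Edge G x₁ y₂
    x₁≁y₂ = tf x₁ x₂ y₂ x₁~x₂ x₂~y₂
    x₃≁y₂ : ¬ Edge G x₃ y₂
    x₃≁y₂ = tf x₃ x₂ y₂ (Edge-sym x₂~x₃) x₂~y₂
    x₂≁y₃ : ¬ Edge G x₂ y₃
    x₂≁y₃ = tf x₂ x₃ y₃ x₂~x₃ x₃~y₃
    x₄≁y₃ : ¬ Edge G x₄ y₃
    x₄≁y₃ = tf x₄ x₃ y₃ (Edge-sym x₃~x₄) x₃~y₃

    faithful : ∀ i j → Edge G (s i) (s j) ⇔ sunspotPattern G i j
    faithful 0F 0F = absent Edge-irrefl reduce
    faithful 0F 1F = present x₁~x₂ (inj₁ tt)
    faithful 0F 2F = absent x₁≁x₃ reduce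
    faithful 0F 3F = present (Edge-sym x₄~x₁) (inj₂ tt)
    faithful 0F 4F = present x₁~y₁ (inj₁ tt)
    faithful 0F 5F = absent x₁≁y₂ reduce
    faithful 0F 6F = absent x₁≁y₃ reduce
    faithful 1F 1F = absent Edge-irrefl reduce
    faithful 1F 2F = present x₂~x₃ (inj₁ tt)
    faithful 1F 3F = absent x₂≁x₄ reduce
    faithful 1F 4F = absent x₂≁y₁ reduce
    faithful 1F 5F = present x₂~y₂ (inj₁ tt)
    faithful 1F 6F = absent x₂≁y₃ reduce
    faithful 2F 2F = absent Edge-irrefl reduce
    faithful 2F 3F = present x₃~x₄ (inj₁ tt)
    faithful 2F 4F = absent x₃≁y₁ reduce
    faithful 2F 5F = absent x₃≁y₂ reduce
    faithful 2F 6F = present x₃~y₃ (inj₁ tt)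
    faithful 3F 3F = absent Edge-irrefl reduce
    faithful 3F 4F = absent x₄≁y₁ reduce
    faithful 3F 5F = absent x₄≁y₂ reduce
    faithful 3F 6F = absent x₄≁y₃ reduce
    faithful 4F 4F = absent Edge-irrefl reduce
    faithful 4F 5F = absent y₁≁y₂ reduce
    faithful 4F 6F = absent y₁≁y₃ reduce
    faithful 5F 5F = absent Edge-irrefl reduce
    faithful 5F 6F = absent y₂≁y₃ reduce
    faithful 6F 6F = absent Edge-irrefl reduce
    faithful 1F 0F = ⇔-flip swap swap (faithful 0F 1F)
    faithful 2F 0F = ⇔-flip swap swap (faithful 0F 2F)
    faithful 3F 0F = ⇔-flip swap swap (faithful 0F 3F)
    faithful 4F 0F = ⇔-flip swap swap (faithful 0F 4F)
    faithful 5F 0F = ⇔-flip swap swap (faithful 0F 5F)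
    faithful 6F 0F = ⇔-flip swap swap (faithful 0F 6F)
    faithful 2F 1F = ⇔-flip swap swap (faithful 1F 2F)
    faithful 3F 1F = ⇔-flip swap swap (faithful 1F 3F)
    faithful 4F 1F = ⇔-flip swap swap (faithful 1F 4F)
    faithful 5F 1F = ⇔-flip swap swap (faithful 1F 5F)
    faithful 6F 1F = ⇔-flip swap swap (faithful 1F 6F)
    faithful 3F 2F = ⇔-flip swap swap (faithful 2F 3F)
    faithful 4F 2F = ⇔-flip swap swap (faithful 2F 4F)
    faithful 5F 2F = ⇔-flip swap swap (faithful 2F 5F)
    faithful 6F 2F = ⇔-flip swap swap (faithful 2F 6F)
    faithful 4F 3F = ⇔-flip swap swap (faithful 3F 4F)
    faithful 5F 3F = ⇔-flip swap swap (faithful 3F 5F)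
    faithful 6F 3F = ⇔-flip swap swap (faithful 3F 6F)
    faithful 5F 4F = ⇔-flip swap swap (faithful 4F 5F)
    faithful 6F 4F = ⇔-flip swap swap (faithful 4F 6F)
    faithful 6F 5F = ⇔-flip swap swap (faithful 5F 6F)

    injective : ∀ i j → s i ≡ s j → i ≡ j
    injective 0F 0F _ = refl
    injective 0F 1F = ⊥-elim ∘ Edge⇒≢ x₁~x₂
    injective 0F 2F = ⊥-elim ∘ ≢-by x₁~y₁ x₃≁y₁
    injective 0F 3F = ⊥-elim ∘ Edge⇒≢ (Edge-sym x₄~x₁)
    injective 0F 4F = ⊥-elim ∘ Edge⇒≢ x₁~y₁
    injective 0F 5F = ⊥-elim ∘ ≢-by x₁~y₁ (≁-sym y₁≁y₂)
    injective 0F 6F = ⊥-elim ∘ ≢-by x₁~y₁ (≁-sym y₁≁y₃)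
    injective 1F 1F _ = refl
    injective 1F 2F = ⊥-elim ∘ Edge⇒≢ x₂~x₃
    injective 1F 3F = ⊥-elim ∘ ≢-by x₂~y₂ x₄≁y₂
    injective 1F 4F = ⊥-elim ∘ ≢-by x₂~y₂ y₁≁y₂
    injective 1F 5F = ⊥-elim ∘ Edge⇒≢ x₂~y₂
    injective 1F 6F = ⊥-elim ∘ ≢-by x₂~y₂ (≁-sym y₂≁y₃)
    injective 2F 2F _ = refl
    injective 2F 3F = ⊥-elim ∘ Edge⇒≢ x₃~x₄
    injective 2F 4F = ⊥-elim ∘ ≢-by x₃~y₃ y₁≁y₃
    injective 2F 5F = ⊥-elim ∘ ≢-by x₃~y₃ y₂≁y₃
    injective 2F 6F = ⊥-elim ∘ Edge⇒≢ x₃~y₃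
    injective 3F 3F _ = refl
    injective 3F 4F = ⊥-elim ∘ ≢-by (Edge-sym x₃~x₄) (≁-sym x₃≁y₁)
    injective 3F 5F = ⊥-elim ∘ ≢-by x₄~x₁ (≁-sym x₁≁y₂)
    injective 3F 6F = ⊥-elim ∘ ≢-by x₄~x₁ (≁-sym x₁≁y₃)
    injective 4F 4F _ = refl
    injective 4F 5F = ⊥-elim ∘ ≢-by (Edge-sym x₁~y₁) (≁-sym x₁≁y₂)
    injective 4F 6F = ⊥-elim ∘ ≢-by (Edge-sym x₁~y₁) (≁-sym x₁≁y₃)
    injective 5F 5F _ = refl
    injective 5F 6F = ⊥-elim ∘ ≢-by (Edge-sym x₂~y₂) (≁-sym x₂≁y₃)
    injective 6F 6F _ = refl
    injective 1F 0F e = sym (injective 0F 1F (sym e))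
    injective 2F 0F e = sym (injective 0F 2F (sym e))
    injective 3F 0F e = sym (injective 0F 3F (sym e))
    injective 4F 0F e = sym (injective 0F 4F (sym e))
    injective 5F 0F e = sym (injective 0F 5F (sym e))
    injective 6F 0F e = sym (injective 0F 6F (sym e))
    injective 2F 1F e = sym (injective 1F 2F (sym e))
    injective 3F 1F e = sym (injective 1F 3F (sym e))
    injective 4F 1F e = sym (injective 1F 4F (sym e))
    injective 5F 1F e = sym (injective 1F 5F (sym e))
    injective 6F 1F e = sym (injective 1F 6F (sym e))
    injective 3F 2F e = sym (injective 2F 3F (sym e))
    injective 4F 2F e = sym (injective 2F 4F (sym e))
    injective 5F 2F e = sym (injective 2F 5F (sym e))
    injective 6F 2F e = sym (injective 2F 6F (sym e))
    injective 4F 3F e = sym (injective 3F 4F (sym e))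
    injective 5F 3F e = sym (injective 3F 5F (sym e))
    injective 6F 3F e = sym (injective 3F 6F (sym e))
    injective 5F 4F e = sym (injective 4F 5F (sym e))
    injective 6F 4F e = sym (injective 4F 6F (sym e))
    injective 6F 5F e = sym (injective 5F 6F (sym e))

  module _ (sf : SunspotFree4 G) where

    private variable
      x h z z' p y b : V G

    pendant-adjacent : Edge G x z → Edge G x z' → Edge G h z → Edge G h z' →
                       Edge G x p → ¬ Edge G p h → Edge G h y → ¬ Edge G p y → ¬ Edge G y x →
                       Edge G z b → ¬ Edge G z' b → ¬ Edge G y b → Edge G b p
    pendant-adjacent x~z x~z' h~z h~z' x~p p≁h h~y p≁y y≁x z~b z'≁b y≁b =
      Edge-stable λ b≁p →
        sf _ (sunspot x~z (Edge-sym h~z) h~z' (Edge-sym x~z') x~p z~b h~y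
                      (≁-sym p≁h) z'≁b (≁-sym y≁x) (≁-sym b≁p) p≁y (≁-sym y≁b))

    no-pendant-square : Liberal G → z ≢ z' →
                        Edge G x z → Edge G x z' → Edge G h z → Edge G h z' →
                        Edge G x p → ¬ Edge G p h → Edge G h y → ¬ Edge G p y →
                        OnlyCommonNeighbour y z h → OnlyCommonNeighbour y z' h → ⊥
    no-pendant-square {z = z} {z' = z'} {x = x} {p = p} {y = y}
                      lib z≢z' x~z x~z' h~z h~z' x~p p≁h h~y p≁y only-h only-h'
      with lib z z' z≢z' (tf z x z' (Edge-sym x~z) x~z')
    ... | (b , z~b , z'≁b) , (b' , z'~b' , z≁b') = tf b b' p b~b' b'~p b~p
      where
      y≁x : ¬ Edge G y x
      y≁x = OnlyCommonNeighbour⇒≁ only-h (Edge-sym x~z) (≢-by x~p (≁-sym p≁h))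
      y≁b : ¬ Edge G y b
      y≁b = OnlyCommonNeighbour⇒≁ only-h z~b (≢-sym (≢-by h~z' (≁-sym z'≁b)))
      y≁b' : ¬ Edge G y b'
      y≁b' = OnlyCommonNeighbour⇒≁ only-h' z'~b' (≢-sym (≢-by h~z (≁-sym z≁b')))
      b~p : Edge G b p
      b~p = pendant-adjacent x~z x~z' h~z h~z' x~p p≁h h~y p≁y y≁x z~b z'≁b y≁b
      b'~p : Edge G b' p
      b'~p = pendant-adjacent x~z' x~z h~z' h~z x~p p≁h h~y p≁y y≁x z'~b' z≁b' y≁b'
      b~b' : Edge G b b'
      b~b' = Edge-stable λ b≁b' →
        sf _ (sunspot (Edge-sym h~z) h~z' (Edge-sym x~z') x~z z~b h~y z'~b'
                      z'≁b (≁-sym y≁x) z≁b' (≁-sym y≁b) b≁b' y≁b')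

module OnHole (G : Graph) (tf : TriangleFree G) (fl : Flapless G) (H : Hole G) (6≤len : 6 ≤ len H) where
  open Basics G
  open Configurations G tf

  private variable
    i j a i' : Fin (len H)
    c d x z : V G

  ∉H⇒≢ : ¬ InHole G H z → vtx H i ≢ z
  ∉H⇒≢ {i = i} z∉H e = z∉H (i , e)

  no-square-on-hole-edge : Edge G (vtx H i) (vtx H j) → Edge G (vtx H j) c → Edge G c d → Edge G d (vtx H i) →
                           vtx H i ≢ c → vtx H j ≢ d → ⊥
  no-square-on-hole-edge {i} {j} hi~hj hj~c c~d d~hi hi≢c hj≢d =
    fl H 6≤len (square-hole hi~hj hj~c c~d d~hi hi≢c hj≢d)
      (refl , _ , _ , (i , j , to (induced H i j) hi~hj , refl , refl) , (0F , 1F , fwd refl , refl , refl))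

  hole-neighbour-only-common : Edge G (vtx H i) (vtx H j) → ¬ InHole G H z → Edge G (vtx H i) z →
                               OnlyCommonNeighbour (vtx H j) z (vtx H i)
  hole-neighbour-only-common {i} hi~hj z∉H hi~z {w} hj~w z~w with w ≟ vtx H i
  ... | yes w≡hi = w≡hi
  ... | no w≢hi =
    ⊥-elim (no-square-on-hole-edge hi~hj hj~w (Edge-sym z~w) (Edge-sym hi~z) (≢-sym w≢hi) (∉H⇒≢ z∉H))

  hole-neighbours : (i : Fin (len H)) → Σ[ j ∈ Fin (len H) ] Σ[ k ∈ Fin (len H) ]
                    vtx H j ≢ vtx H k × Edge G (vtx H i) (vtx H j) × Edge G (vtx H i) (vtx H k)
  hole-neighbours i with cycle-neighbours (<⇒≤ (len≥4 H)) i
  ... | j , k , j≢k , i-j , i-k =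
    j , k , j≢k ∘ inj H j k , from (induced H i j) i-j , from (induced H i k) i-k

  hole-neighbour-avoiding : vtx H a ≢ vtx H i →
                            Σ[ j ∈ Fin (len H) ] Edge G (vtx H i) (vtx H j) × ¬ Edge G (vtx H a) (vtx H j)
  hole-neighbour-avoiding {a} {i} a≢i with hole-neighbours i
  ... | j , k , j≢k , i~j , i~k with edge? (vtx H a) (vtx H j) | edge? (vtx H a) (vtx H k)
  ... | no a≁j | _ = j , i~j , a≁j
  ... | yes _ | no a≁k = k , i~k , a≁k
  ... | yes a~j | yes a~k = ⊥-elim (no-square-on-hole-edge a~j (Edge-sym i~j) i~k (Edge-sym a~k) a≢i j≢k)

  module _ (Φ : Flare G H) where
    open Flare Φ using (nbr; outH)

    adjacent-no-common-neighbour : FlareClosed G Φ i x → Edge G (vtx H i) (vtx H i') →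
                                   ¬ (∃[ z ] (¬ InHole G H z × Edge G x z × Edge G (vtx H i') z))
    adjacent-no-common-neighbour (inj₂ refl) h~h' (z , _ , h~z , h'~z) = tf _ _ _ h~h' h'~z h~z
    adjacent-no-common-neighbour {i} {x} (inj₁ x∈Φh) h~h' (z , z∉H , x~z , h'~z) =
      no-square-on-hole-edge h~h' h'~z (Edge-sym x~z) (Edge-sym (nbr i x x∈Φh))
                             (∉H⇒≢ z∉H) (∉H⇒≢ (outH i x x∈Φh))

    flare-anchor : FlareClosed G Φ i x → vtx H i ≢ vtx H i' → ¬ Edge G (vtx H i) (vtx H i') →
                   ¬ InHole G H z → Edge G x z → Edge G (vtx H i') z →
                   Σ[ p ∈ Fin (len H) ] Edge G x (vtx H p) × ¬ Edge G (vtx H p) (vtx H i') × vtx H p ≢ vtx H i'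
    flare-anchor {i} {x} (inj₁ x∈Φh) h≢h' h≁h' _ _ _ = i , Edge-sym (nbr i x x∈Φh) , h≁h' , h≢h'
    flare-anchor {i} {i' = i'} (inj₂ refl) h≢h' h≁h' z∉H h~z h'~z with hole-neighbours i
    ... | j , _ , _ , h~j , _ = j , h~j , j≁h' , ≢-by (Edge-sym h~j) (≁-sym h≁h')
      where
      j≁h' : ¬ Edge G (vtx H j) (vtx H i')
      j≁h' j~h' = no-square-on-hole-edge h~j j~h' h'~z (Edge-sym h~z) h≢h' (∉H⇒≢ z∉H)

    nonadjacent-common-neighbours-unique :
      SunspotFree4 G → Liberal G → FlareClosed G Φ i x →
      vtx H i ≢ vtx H i' → ¬ Edge G (vtx H i) (vtx H i') →
      ∀ z z' → ¬ InHole G H z → Edge G x z → Edge G (vtx H i') z →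
               ¬ InHole G H z' → Edge G x z' → Edge G (vtx H i') z' → z ≡ z'
    nonadjacent-common-neighbours-unique sf lib x∈Φ[h] h≢h' h≁h' z z' z∉H x~z h'~z z'∉H x~z' h'~z'
      with z ≟ z'
    ... | yes z≡z' = z≡z'
    ... | no z≢z' with flare-anchor x∈Φ[h] h≢h' h≁h' z∉H x~z h'~z
    ... | p , x~p , p≁h' , p≢h' with hole-neighbour-avoiding p≢h'
    ... | j , h'~y , p≁y =
      ⊥-elim (no-pendant-square sf lib z≢z' x~z x~z' h'~z h'~z' x~p p≁h' h'~y p≁y
                (hole-neighbour-only-common h'~y z∉H h'~z) (hole-neighbour-only-common h'~y z'∉H h'~z'))

lemma3p2 : (G : Graph) → TriangleFree G → SunspotFree4 G → Liberal G → Flapless G →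
    (H : Hole G) → 6 ≤ len H → (Φ : Flare G H) →
    (i i' : _) → vtx H i ≢ vtx H i' → (x : V G) → FlareClosed G Φ i x →
    (Edge G (vtx H i) (vtx H i') →
       ¬ (∃[ z ] (¬ InHole G H z × Edge G x z × Edge G (vtx H i') z)))
    × (¬ Edge G (vtx H i) (vtx H i') →
       ∀ z z' → ¬ InHole G H z → Edge G x z → Edge G (vtx H i') z →
                ¬ InHole G H z' → Edge G x z' → Edge G (vtx H i') z' → z ≡ z')
lemma3p2 G tf sf lib fl H 6≤len Φ i i' h≢h' x x∈Φ[h] =
    adjacent-no-common-neighbour Φ x∈Φ[h]
  , nonadjacent-common-neighbours-unique Φ sf lib x∈Φ[h] h≢h'
  where open OnHole G tf fl H 6≤len
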